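{- Let $w$ be a permutation, $P$ a marked reduced pipe dream of $w$, and $j\ne j'$ two entries such that pipes $j$ and $j'$ are both removable in $P$. Then pipe $j'$ is removable in $\Phi_j(P)$, and \[\Phi_{j'}(\Phi_j(P))=\Phi_j(\Phi_{j'}(P)).\]
   Context: Pipe dreams. Let $v$ be a word (finite sequence of distinct positive integers) of length $m$ with entries $a_1<\cdots<a_m$. The staircase of rank $m$ consists of cells $(i,k)$, $i,k\ge1$, $i+k\le m+1$ (row $i$ from the top, column $k$ from the left). Fill each cell with a crossing tile (a vertical segment top-to-bottom crossing a horizontal segment right-to-left) or a bumping tile (one arc joining top edge to left edge, another joining right edge to bottom edge), with cells satisfying $i+k=m+1$ bumping. The pipe labelled $a_k$ enters at the top of column $k$ and follows the segments, moving down and left, until it exits through the left boundary. This is a reduced pipe dream of $v$ if any two pipes meet in at most one crossing tile and the labels read on the left boundary from top to bottom form $v$. A marked reduced pipe dream of $v$ is a reduced pipe dream of $v$ with a set of marked bumping tiles, where a bumping tile in row $i$ may be marked only if its two pipes cross at some crossing tile in a row strictly above row $i$. For a permutation $w\in S_n$ the labels are $1,\dots,n$. Removable pipes. In a marked reduced pipe dream $P$, pipe $j$ is removable if: (i) the column where pipe $j$ enters consists, from top to bottom, of crossing tiles all traversed by pipe $j$, followed by unmarked bumping tiles only; (ii) for each crossing tile traversed by pipe $j$, the tile directly above it (if any) is not an unmarked bumping tile; (iii) pipe $j$ traverses no marked bumping tile. The map $\Phi_j$ (for pipe $j$ removable in $P$ of rank $m$). Let $c$ be the column where pipe $j$ enters.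 In each column $k<c$, pipe $j$ passes either through a single crossing tile $(r_k,k)$ horizontally, or through two vertically adjacent unmarked bumping tiles $(r_k,k),(r_k+1,k)$. $\Phi_j(P)$ is the filling of the rank $m-1$ staircase defined by: for $k>c$, column $k-1$ of $\Phi_j(P)$ is column $k$ of $P$; column $c$ is deleted; for $k<c$, cells $(r,k)$ with $r<r_k$ are unchanged, and in the crossing case cell $(r,k)$, $r\ge r_k$, receives the tile (with mark) of $(r+1,k)$ of $P$, while in the bumping case cell $(r_k,k)$ receives an unmarked bumping tile and cell $(r,k)$, $r>r_k$, receives the tile (with mark) of $(r+1,k)$ of $P$. (I.e. delete column $c$ and the unit region traversed by pipe $j$ in each column to its left, then close the gaps.) Pipes of $\Phi_j(P)$ keep their labels; it is a marked reduced pipe dream of the word obtained by deleting $j$, and removability and $\Phi_{j'}$ are defined for it in the same way. -}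

module Defs where

open import Data.Nat using (ℕ; zero; suc; _+_; _∸_; _≤_; _<_; pred)
open import Data.Nat.Base using (_<ᵇ_; _≡ᵇ_; _≤ᵇ_)
open import Data.Bool using (Bool; true; false; if_then_else_; _∧_)
open import Data.Fin using (Fin; toℕ)
open import Data.Fin.Permutation using (Permutation′; _⟨$⟩ʳ_)
open import Data.Vec as Vec using (Vec)
open import Data.List as List using (List; []; _∷_; upTo; length)
open import Data.List.Membership.Propositional using (_∈_)
open import Data.List.Relation.Unary.Linked using (Linked)
open import Data.List.Relation.Binary.Permutation.Propositional using (_↭_)
open import Data.Maybe using (Maybe; just; nothing)
open import Data.Product using (_×_; _,_; ∃; Σ)
open import Relation.Binary.PropositionalEquality using (_≡_; _≢_)

-- Tiles.  A bumping tile carries a mark flag (true = marked).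

data Tile : Set where
  cross : Tile
  bump  : Bool → Tile

-- Column k (1-indexed, from the
-- left) has m+1-k cells; a filling of rank (suc m) is its first column
-- (m+1 cells, top to bottom) followed by a filling of rank m (columns 2,3,…).

data Staircase : ℕ → Set where
  nil : Staircase zero
  _◂_ : ∀ {m} → Vec Tile (suc m) → Staircase m → Staircase (suc m)

infixr 5 _◂_

-- i-th entry (1-indexed) of a column; default outside.
atV : ∀ {n} → Vec Tile n → ℕ → Tile
atV Vec.[] _ = bump false
atV (t Vec.∷ ts) zero = bump false
atV (t Vec.∷ ts) (suc zero) = t
atV (t Vec.∷ ts) (suc (suc i)) = atV ts (suc i)

-- tile in cell (row i, column k), 1-indexed; an (irrelevant) default
-- value outside the staircase.
at : ∀ {m} → Staircase m → ℕ → ℕ → Tile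
at nil _ _ = bump false
at (col ◂ S) i zero = bump false
at (col ◂ S) i (suc zero) = atV col i
at (col ◂ S) i (suc (suc k)) = at S i (suc k)

build : (m : ℕ) → (ℕ → ℕ → Tile) → Staircase m
build zero f = nil
build (suc m) f = Vec.tabulate (λ (r : Fin (suc m)) → f (suc (toℕ r)) 1)
                  ◂ build m (λ i k → f i (suc k))

InStair : ℕ → ℕ → ℕ → Set
InStair m i k = (1 ≤ i) × (1 ≤ k) × (i + k ≤ suc m)

inStairᵇ : ℕ → ℕ → ℕ → Bool
inStairᵇ m i k = (1 ≤ᵇ i) ∧ (1 ≤ᵇ k) ∧ (i + k ≤ᵇ suc m)

-- Following pipes.  A pipe enters a cell from the top or from the right.
-- crossing tile: top → bottom, right → left;
-- bumping tile : top → left,   right → bottom.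

data Dir : Set where
  fromTop fromRight : Dir

exitsLeft : Tile → Dir → Bool
exitsLeft cross fromTop = false
exitsLeft cross fromRight = true
exitsLeft (bump _) fromTop = true
exitsLeft (bump _) fromRight = false

Cell : Set
Cell = ℕ × ℕ   -- (row , column)

trace : ∀ {m} → Staircase m → (fuel : ℕ) → ℕ → ℕ → Dir → List Cell
trace P zero i k d = []
trace {m} P (suc f) i k d =
  if inStairᵇ m i k then (i , k) ∷ next k else []
  where
  next : ℕ → List Cell
  next zero = []
  next (suc zero) = if exitsLeft (at P i 1) d then [] else trace P f (suc i) 1 fromTop
  next (suc (suc k')) = if exitsLeft (at P i (suc (suc k'))) d
                         then trace P f i (suc k') fromRight
                         else trace P f (suc i) (suc (suc k')) fromTop

exitTrace : ∀ {m} → Staircase m → (fuel : ℕ) → ℕ → ℕ → Dir → Maybe ℕ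
exitTrace P zero i k d = nothing
exitTrace {m} P (suc f) i k d =
  if inStairᵇ m i k then next k else nothing
  where
  next : ℕ → Maybe ℕ
  next zero = nothing
  next (suc zero) = if exitsLeft (at P i 1) d then just i else exitTrace P f (suc i) 1 fromTop
  next (suc (suc k')) = if exitsLeft (at P i (suc (suc k'))) d
                         then exitTrace P f i (suc k') fromRight
                         else exitTrace P f (suc i) (suc (suc k')) fromTop

-- cells traversed by the pipe entering at the top of column c
-- (fuel m + m is more than the at most 2m-1 cells a pipe can visit)
Visits : ∀ {m} → Staircase m → ℕ → List Cell
Visits {m} P c = trace P (m + m) 1 c fromTop

exitRow : ∀ {m} → Staircase m → ℕ → Maybe ℕ
exitRow {m} P c = exitTrace P (m + m) 1 c fromTop

-- row of the first (topmost) cell of column k in a list of cells (0 if none)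
firstRowIn : ℕ → List Cell → ℕ
firstRowIn k [] = 0
firstRowIn k ((i , k') ∷ cs) = if k ≡ᵇ k' then i else firstRowIn k cs

-- Labelled fillings: the labels a₁ < … < a_m, pipe a_k entering column k.

record LDream (m : ℕ) : Set where
  constructor ⟨_,_⟩
  field
    labels : List ℕ
    tiles  : Staircase m
open LDream public

-- 1-indexed position of a label in a list (0 if absent)
colOf : List ℕ → ℕ → ℕ
colOf [] j = 0
colOf (a ∷ as) j = if a ≡ᵇ j then 1 else suc (colOf as j)

-- r-th entry (1-indexed)
nth : List ℕ → ℕ → Maybe ℕ
nth [] r = nothing
nth (a ∷ as) zero = nothing
nth (a ∷ as) (suc zero) = just a
nth (a ∷ as) (suc (suc r)) = nth as (suc r)

delete : ℕ → List ℕ → List ℕ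
delete j [] = []
delete j (a ∷ as) = if a ≡ᵇ j then as else a ∷ delete j as

IsMarkedRPD : ∀ {m} → List ℕ → LDream m → Set
IsMarkedRPD {m} v ⟨ ls , P ⟩ =
  (length ls ≡ m) × Linked _<_ ls × (ls ↭ v)
  × (∀ i k → 1 ≤ i → 1 ≤ k → i + k ≡ suc m → Σ Bool (λ b → at P i k ≡ bump b))
  -- reduced: two distinct pipes meet in at most one crossing tile
  × (∀ c c' → 1 ≤ c → c ≤ m → 1 ≤ c' → c' ≤ m → c ≢ c' →
       ∀ (x y : Cell) →
       at P (Data.Product.proj₁ x) (Data.Product.proj₂ x) ≡ cross → x ∈ Visits P c → x ∈ Visits P c' →
       at P (Data.Product.proj₁ y) (Data.Product.proj₂ y) ≡ cross → y ∈ Visits P c → y ∈ Visits P c' →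
       x ≡ y)
  -- labels read on the left boundary, top to bottom, form v
  × (∀ c → 1 ≤ c → c ≤ m → ∃ λ r → exitRow P c ≡ just r × nth v r ≡ nth ls c)
  -- a marked bumping tile in row i: its two pipes cross strictly above row i
  × (∀ i k → InStair m i k → at P i k ≡ bump true →
       ∃ λ c → ∃ λ c' → (1 ≤ c) × (c ≤ m) × (1 ≤ c') × (c' ≤ m) × (c ≢ c')
         × ((i , k) ∈ Visits P c) × ((i , k) ∈ Visits P c')
         × ∃ λ i' → ∃ λ k' → (i' < i) × (at P i' k' ≡ cross)
             × ((i' , k') ∈ Visits P c) × ((i' , k') ∈ Visits P c'))

-- the word w(1) w(2) … w(n) of a permutation w ∈ S_n (values 1..n)
wordOf : ∀ {n} → Permutation′ n → List ℕ
wordOf {n} w = List.map (λ (r : Fin n) → suc (toℕ (w ⟨$⟩ʳ r))) (List.allFin n)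

permDream : ∀ {n} → Staircase n → LDream n
permDream {n} P = ⟨ List.map suc (upTo n) , P ⟩

IsMarkedRPDPerm : ∀ {n} → Permutation′ n → Staircase n → Set
IsMarkedRPDPerm w P = IsMarkedRPD (wordOf w) (permDream P)

RemovableCol : ∀ {m} → Staircase m → ℕ → Set
RemovableCol {m} P c =
  (∃ λ t → (∀ i → 1 ≤ i → i ≤ t → (at P i c ≡ cross) × ((i , c) ∈ Visits P c))
         × (∀ i → t < i → i + c ≤ suc m → at P i c ≡ bump false))
  × (∀ i k → (i , k) ∈ Visits P c → at P i k ≡ cross → 2 ≤ i → at P (pred i) k ≢ bump false)
  × (∀ i k → (i , k) ∈ Visits P c → at P i k ≢ bump true)

Removable : ∀ {m} → LDream m → ℕ → Set
Removable ⟨ ls , P ⟩ j = (j ∈ ls) × RemovableCol P (colOf ls j)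

ΦcolTile : ∀ {m} → Staircase m → ℕ → ℕ → ℕ → Tile
ΦcolTile P c r k =
  if k <ᵇ c then
    (let rk = firstRowIn k (Visits P c) in
     if r <ᵇ rk then at P r k else
       (tileCase (at P rk k) rk))
  else at P r (suc k)
  where
  tileCase : Tile → ℕ → Tile
  tileCase cross rk = at P (suc r) k
  tileCase (bump _) rk = if r ≡ᵇ rk then bump false else at P (suc r) k

Φ : ∀ {m} → ℕ → LDream m → LDream (m ∸ 1)
Φ {m} j ⟨ ls , P ⟩ = ⟨ delete j ls , build (m ∸ 1) (ΦcolTile P (colOf ls j)) ⟩

-- Deleting a removable pipe c is a reindexing of cells: cell (r , k) of Φ_c P
-- is the cell of P reached by skipping column c and, in each column k < c,
-- the row E k in which pipe c enters that column.  Removability makes the path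
-- of a pipe rigid: a run of crossings down its own column, then a descent
-- through single crossings and stacked pairs of unmarked bumps.  Where the
-- descents of two removable pipes c and c' share columns, one stays strictly
-- above the other, so deleting pipe c carries the path of c' to a path of the
-- same shape in Φ_c P; its entry rows E'' there and E' in P are related by
-- punchIn (E k) (E'' k) = E' k.  Both Φ_c' ∘ Φ_c and Φ_c ∘ Φ_c' are then
-- reindexings of P, and they agree column by column since
--   punchIn a ∘ punchIn (punchOut a b) = punchIn b ∘ punchIn (punchOut b a).

module Submission where

open import Defs
open import Data.Bool using (Bool; true; false; if_then_else_; T)
open import Data.Unit using (tt)
open import Data.Nat using (ℕ; zero; suc; _+_; _∸_; _≤_; _<_; pred; z≤n; s≤s; _≤?_; _<?_; _≟_)
open import Data.Fin.Permutation using (Permutation′)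
open import Data.Nat.Base using (_<ᵇ_; _≡ᵇ_; _≤ᵇ_)
open import Data.Nat.Properties
open import Data.Product using (_×_; _,_; Σ; ∃; proj₁; proj₂; uncurry)
open import Data.Sum using (_⊎_; inj₁; inj₂)
open import Data.List using (List; []; _∷_; _++_; length)
open import Data.List.Membership.Propositional using (_∈_)
open import Data.List.Membership.Propositional.Properties using (∈-++⁺ˡ)
open import Data.List.Relation.Unary.Any using (here; there)
open import Data.List.Relation.Unary.All as All using (All; []; _∷_)
import Data.List.Relation.Unary.All.Properties as All
open import Data.Vec as Vec using (Vec; []; _∷_)
open import Data.Vec.Properties using (tabulate-cong)
open import Data.Fin using (toℕ)
open import Data.Fin.Properties using (toℕ<n)
open import Data.Nat.Tactic.RingSolver using (solve-∀)
open import Relation.Nullary using (yes; no; contradiction)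
open import Relation.Binary.Definitions using (tri<; tri≈; tri>)
open import Function using (_∘_; case_of_)
open import Relation.Binary.PropositionalEquality
open ≡-Reasoning

<ᵇ-true : ∀ {m n} → m < n → (m <ᵇ n) ≡ true
<ᵇ-true {zero} (s≤s _) = refl
<ᵇ-true {suc m} (s≤s m<n@(s≤s _)) = <ᵇ-true m<n

<ᵇ≡true⇒< : ∀ {m n} → (m <ᵇ n) ≡ true → m < n
<ᵇ≡true⇒< {m} {n} m<ᵇn = <ᵇ⇒< m n (subst T (sym m<ᵇn) tt)

≡ᵇ≡true⇒≡ : ∀ {m n} → (m ≡ᵇ n) ≡ true → m ≡ n
≡ᵇ≡true⇒≡ {m} {n} m≡ᵇn = ≡ᵇ⇒≡ m n (subst T (sym m≡ᵇn) tt)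

≤ᵇ-true : ∀ {m n} → m ≤ n → (m ≤ᵇ n) ≡ true
≤ᵇ-true z≤n = refl
≤ᵇ-true m≤n@(s≤s _) = <ᵇ-true m≤n

<ᵇ-false : ∀ {m n} → n ≤ m → (m <ᵇ n) ≡ false
<ᵇ-false z≤n = refl
<ᵇ-false (s≤s n≤m) = <ᵇ-false n≤m

≡ᵇ-refl : ∀ n → (n ≡ᵇ n) ≡ true
≡ᵇ-refl zero = refl
≡ᵇ-refl (suc n) = ≡ᵇ-refl n

≡ᵇ-false : ∀ {m n} → m ≢ n → (m ≡ᵇ n) ≡ false
≡ᵇ-false {zero} {zero} m≢n = contradiction refl m≢n
≡ᵇ-false {zero} {suc n} _ = refl
≡ᵇ-false {suc m} {zero} _ = refl
≡ᵇ-false {suc m} {suc n} m≢n = ≡ᵇ-false (m≢n ∘ cong suc)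

-- Inserting and removing a row

punchIn : ℕ → ℕ → ℕ
punchIn i j = if j <ᵇ i then j else suc j

punchOut : ℕ → ℕ → ℕ
punchOut i j = if j <ᵇ i then j else pred j

punchIn-< : ∀ {i j} → j < i → punchIn i j ≡ j
punchIn-< j<i rewrite <ᵇ-true j<i = refl

punchIn-≥ : ∀ {i j} → i ≤ j → punchIn i j ≡ suc j
punchIn-≥ i≤j rewrite <ᵇ-false i≤j = refl

punchOut-< : ∀ {i j} → j < i → punchOut i j ≡ j
punchOut-< j<i rewrite <ᵇ-true j<i = refl

punchOut-≥ : ∀ {i j} → i ≤ j → punchOut i j ≡ pred j
punchOut-≥ i≤j rewrite <ᵇ-false i≤j = refl

j≤punchIn : ∀ i j → j ≤ punchIn i j
j≤punchIn i j with j <ᵇ i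
... | true = ≤-refl
... | false = n≤1+n j

punchIn≤1+j : ∀ i j → punchIn i j ≤ suc j
punchIn≤1+j i j with j <ᵇ i
... | true = n≤1+n j
... | false = ≤-refl

suc-pred-< : ∀ {i j} → i < j → suc (pred j) ≡ j
suc-pred-< (s≤s _) = refl

punchIn-≢ : ∀ i j → punchIn i j ≢ i
punchIn-≢ i j with j <? i
... | yes j<i = λ eq → <-irrefl (trans (sym (punchIn-< j<i)) eq) j<i
... | no j≮i = λ eq → <-irrefl (sym eq) (subst (i <_) (sym (punchIn-≥ (≮⇒≥ j≮i))) (s≤s (≮⇒≥ j≮i)))

punchOut-punchIn : ∀ i j → punchOut i (punchIn i j) ≡ j
punchOut-punchIn i j with j <? i
... | yes j<i rewrite punchIn-< j<i = punchOut-< j<i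
... | no j≮i rewrite punchIn-≥ (≮⇒≥ j≮i) = punchOut-≥ (m≤n⇒m≤1+n (≮⇒≥ j≮i))

punchOut-suc : ∀ {i j} → 1 ≤ j → punchOut (suc i) (suc j) ≡ suc (punchOut i j)
punchOut-suc {i} {j} 1≤j with j <? i
... | yes j<i = trans (punchOut-< (s≤s j<i)) (cong suc (sym (punchOut-< j<i)))
... | no j≮i =
  trans (punchOut-≥ (s≤s (≮⇒≥ j≮i))) (trans (sym (suc-pred-< 1≤j)) (cong suc (sym (punchOut-≥ (≮⇒≥ j≮i)))))

punchIn-punchIn : ∀ {i j} r → i < j → punchIn j (punchIn i r) ≡ punchIn i (punchIn (pred j) r)
punchIn-punchIn {i} {suc j} r i<j with r <? i | r <? j
... | yes r<i | _ = begin
  punchIn (suc j) (punchIn i r) ≡⟨ cong (punchIn (suc j)) (punchIn-< r<i) ⟩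
  punchIn (suc j) r             ≡⟨ punchIn-< (<-trans r<i i<j) ⟩
  r                             ≡⟨ sym (punchIn-< r<i) ⟩
  punchIn i r                   ≡⟨ cong (punchIn i) (sym (punchIn-< (<-≤-trans r<i (≤-pred i<j)))) ⟩
  punchIn i (punchIn j r)       ∎
... | no r≮i | yes r<j = begin
  punchIn (suc j) (punchIn i r) ≡⟨ cong (punchIn (suc j)) (punchIn-≥ (≮⇒≥ r≮i)) ⟩
  punchIn (suc j) (suc r)       ≡⟨ punchIn-< (s≤s r<j) ⟩
  suc r                         ≡⟨ sym (punchIn-≥ (≮⇒≥ r≮i)) ⟩
  punchIn i r                   ≡⟨ cong (punchIn i) (sym (punchIn-< r<j)) ⟩
  punchIn i (punchIn j r)       ∎
... | no r≮i | no r≮j = begin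
  punchIn (suc j) (punchIn i r) ≡⟨ cong (punchIn (suc j)) (punchIn-≥ (≮⇒≥ r≮i)) ⟩
  punchIn (suc j) (suc r)       ≡⟨ punchIn-≥ (s≤s (≮⇒≥ r≮j)) ⟩
  suc (suc r)                   ≡⟨ sym (punchIn-≥ (m≤n⇒m≤1+n (≮⇒≥ r≮i))) ⟩
  punchIn i (suc r)             ≡⟨ cong (punchIn i) (sym (punchIn-≥ (≮⇒≥ r≮j))) ⟩
  punchIn i (punchIn j r)       ∎

punchIn-comm : ∀ {i j} r → i ≢ j →
  punchIn i (punchIn (punchOut i j) r) ≡ punchIn j (punchIn (punchOut j i) r)
punchIn-comm {i} {j} r i≢j with <-cmp i j
... | tri≈ _ i≡j _ = contradiction i≡j i≢j
... | tri< i<j _ _ rewrite punchOut-≥ (<⇒≤ i<j) | punchOut-< i<j = sym (punchIn-punchIn r i<j)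
... | tri> _ _ j<i rewrite punchOut-< j<i | punchOut-≥ (<⇒≤ j<i) = punchIn-punchIn r j<i

punchIn-swap : ∀ {a b x y} r → punchIn a x ≡ b → punchIn b y ≡ a →
  punchIn a (punchIn x r) ≡ punchIn b (punchIn y r)
punchIn-swap {a} {b} {x} {y} r refl b↦a = begin
  punchIn a (punchIn x r)
    ≡⟨ cong (λ z → punchIn a (punchIn z r)) (sym (punchOut-punchIn a x)) ⟩
  punchIn a (punchIn (punchOut a b) r)
    ≡⟨ punchIn-comm r (λ a≡b → punchIn-≢ a x (sym a≡b)) ⟩
  punchIn b (punchIn (punchOut b a) r)
    ≡⟨ cong (λ z → punchIn b (punchIn (punchOut b z) r)) (sym b↦a) ⟩
  punchIn b (punchIn (punchOut b (punchIn b y)) r)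
    ≡⟨ cong (λ z → punchIn b (punchIn z r)) (punchOut-punchIn b y) ⟩
  punchIn b (punchIn y r) ∎

-- Reindexing cells

liftRow : (ℕ → ℕ) → ℕ → ℕ → ℕ → ℕ
liftRow E c k r = if k <ᵇ c then punchIn (E k) r else r

-- Cell (r , k) of Φ_c P is the cell source E c (r , k) of P, where E k is the
-- row in which the removed pipe enters column k.
source : (ℕ → ℕ) → ℕ → Cell → Cell
source E c (r , k) = liftRow E c k r , punchIn c k

liftRow-< : ∀ {E c k r} → k < c → liftRow E c k r ≡ punchIn (E k) r
liftRow-< k<c rewrite <ᵇ-true k<c = refl

liftRow-≥ : ∀ {E c k r} → c ≤ k → liftRow E c k r ≡ r
liftRow-≥ c≤k rewrite <ᵇ-false c≤k = refl

source-moves : ∀ E c r k → (k < c → E k ≤ r) →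
  suc (r + k) ≤ proj₁ (source E c (r , k)) + proj₂ (source E c (r , k))
source-moves E c r k below with k <? c
... | yes k<c rewrite liftRow-< {E} {r = r} k<c | punchIn-< k<c | punchIn-≥ (below k<c) = ≤-refl
... | no k≮c rewrite liftRow-≥ {E} {r = r} (≮⇒≥ k≮c) | punchIn-≥ (≮⇒≥ k≮c) =
  ≤-reflexive (sym (+-suc r k))

-- source E c sends the entry cell (E'' k , k) of a pipe in Φ_c P to its entry
-- cell in P.
Relocates : (ℕ → ℕ) → ℕ → (ℕ → ℕ) → (ℕ → ℕ) → ℕ → Set
Relocates E c E'' E' n = ∀ k → 1 ≤ k → k < n → liftRow E c k (E'' k) ≡ E' (punchIn c k)

liftRow-comm-< : ∀ {c c' E E' E'' Ẽ} → c < c' → Relocates E c E'' E' (pred c') → Relocates E' c' Ẽ E c →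
  ∀ r k → 1 ≤ k →
  liftRow E c (punchIn (pred c') k) (liftRow E'' (pred c') k r) ≡ liftRow E' c' (punchIn c k) (liftRow Ẽ c k r)
liftRow-comm-< {c} {c'} {E} {E'} {E''} {Ẽ} c<c' relocates relocates' r k 1≤k with k <? c | k <? pred c'
... | yes k<c | _ = begin
  liftRow E c (punchIn (pred c') k) (liftRow E'' (pred c') k r)
    ≡⟨ cong₂ (liftRow E c) (punchIn-< k<c'-1) (liftRow-< {E''} k<c'-1) ⟩
  liftRow E c k (punchIn (E'' k) r)
    ≡⟨ liftRow-< {E} k<c ⟩
  punchIn (E k) (punchIn (E'' k) r)
    ≡⟨ punchIn-swap r E''↦E' Ẽ↦E ⟩
  punchIn (E' k) (punchIn (Ẽ k) r)
    ≡⟨ sym (liftRow-< {E'} k<c') ⟩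
  liftRow E' c' k (punchIn (Ẽ k) r)
    ≡⟨ sym (cong₂ (liftRow E' c') (punchIn-< k<c) (liftRow-< {Ẽ} k<c)) ⟩
  liftRow E' c' (punchIn c k) (liftRow Ẽ c k r) ∎
  where
  k<c'-1 = <-≤-trans k<c (<⇒≤pred c<c')
  k<c' = <-trans k<c c<c'
  E''↦E' : punchIn (E k) (E'' k) ≡ E' k
  E''↦E' = trans (sym (liftRow-< {E} k<c)) (trans (relocates k 1≤k k<c'-1) (cong E' (punchIn-< k<c)))
  Ẽ↦E : punchIn (E' k) (Ẽ k) ≡ E k
  Ẽ↦E = trans (sym (liftRow-< {E'} k<c')) (trans (relocates' k 1≤k k<c) (cong E (punchIn-< k<c')))
... | no k≮c | yes k<c'-1 = begin
  liftRow E c (punchIn (pred c') k) (liftRow E'' (pred c') k r)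
    ≡⟨ cong₂ (liftRow E c) (punchIn-< k<c'-1) (liftRow-< {E''} k<c'-1) ⟩
  liftRow E c k (punchIn (E'' k) r)
    ≡⟨ liftRow-≥ {E} c≤k ⟩
  punchIn (E'' k) r
    ≡⟨ cong (λ e → punchIn e r) E''≡E' ⟩
  punchIn (E' (suc k)) r
    ≡⟨ sym (liftRow-< {E'} (≤-trans (s≤s k<c'-1) (≤-reflexive (suc-pred-< c<c')))) ⟩
  liftRow E' c' (suc k) r
    ≡⟨ sym (cong₂ (liftRow E' c') (punchIn-≥ c≤k) (liftRow-≥ {Ẽ} c≤k)) ⟩
  liftRow E' c' (punchIn c k) (liftRow Ẽ c k r) ∎
  where
  c≤k = ≮⇒≥ k≮c
  E''≡E' : E'' k ≡ E' (suc k)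
  E''≡E' = trans (sym (liftRow-≥ {E} c≤k)) (trans (relocates k 1≤k k<c'-1) (cong E' (punchIn-≥ c≤k)))
... | no k≮c | no k≮c'-1 = begin
  liftRow E c (punchIn (pred c') k) (liftRow E'' (pred c') k r)
    ≡⟨ cong₂ (liftRow E c) (punchIn-≥ c'-1≤k) (liftRow-≥ {E''} c'-1≤k) ⟩
  liftRow E c (suc k) r
    ≡⟨ liftRow-≥ {E} (m≤n⇒m≤1+n c≤k) ⟩
  r
    ≡⟨ sym (liftRow-≥ {E'} (≤-trans (≤-reflexive (sym (suc-pred-< c<c'))) (s≤s c'-1≤k))) ⟩
  liftRow E' c' (suc k) r
    ≡⟨ sym (cong₂ (liftRow E' c') (punchIn-≥ c≤k) (liftRow-≥ {Ẽ} c≤k)) ⟩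
  liftRow E' c' (punchIn c k) (liftRow Ẽ c k r) ∎
  where
  c≤k = ≮⇒≥ k≮c
  c'-1≤k = ≮⇒≥ k≮c'-1

source-comm-< : ∀ {c c' E E' E'' Ẽ} → c < c' → Relocates E c E'' E' (pred c') → Relocates E' c' Ẽ E c →
  ∀ r k → 1 ≤ k → source E c (source E'' (pred c') (r , k)) ≡ source E' c' (source Ẽ c (r , k))
source-comm-< {E = E} {E'} {E''} {Ẽ} c<c' relocates relocates' r k 1≤k =
  cong₂ _,_ (liftRow-comm-< {E = E} {E'} {E''} {Ẽ} c<c' relocates relocates' r k 1≤k) (sym (punchIn-punchIn k c<c'))

source-comm : ∀ {c c' E E' E'' Ẽ} → c ≢ c' →
  Relocates E c E'' E' (punchOut c c') → Relocates E' c' Ẽ E (punchOut c' c) → ∀ r k → 1 ≤ k →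
  source E c (source E'' (punchOut c c') (r , k)) ≡ source E' c' (source Ẽ (punchOut c' c) (r , k))
source-comm {c} {c'} {E} {E'} {E''} {Ẽ} c≢c' relocates relocates' r k 1≤k with <-cmp c c'
... | tri≈ _ c≡c' _ = contradiction c≡c' c≢c'
... | tri< c<c' _ _ rewrite punchOut-≥ (<⇒≤ c<c') | punchOut-< c<c' =
  source-comm-< {E = E} {E'} {E''} {Ẽ} c<c' relocates relocates' r k 1≤k
... | tri> _ _ c'<c rewrite punchOut-< c'<c | punchOut-≥ (<⇒≤ c'<c) =
  sym (source-comm-< {E = E'} {E} {Ẽ} {E''} c'<c relocates' relocates r k 1≤k)

-- Descents

top-or-below : ∀ {k K} → k ≤ suc K → k ≡ suc K ⊎ k ≤ K
top-or-below k≤ with m≤n⇒m<n∨m≡n k≤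
... | inj₁ (s≤s k≤K) = inj₂ k≤K
... | inj₂ k≡ = inj₁ k≡

Grid : Set
Grid = ℕ → ℕ → Tile

-- A pipe entering column K from the right in row s and running to the left
-- boundary the way a removable pipe must: in each column either straight
-- through a crossing (whose upper neighbour is not an unmarked bump), or down
-- through two stacked unmarked bumps.
data Descent (f : Grid) : ℕ → ℕ → Set where
  done   : ∀ {s} → Descent f s 0
  across : ∀ {s K} → f s (suc K) ≡ cross → (2 ≤ s → f (pred s) (suc K) ≢ bump false) →
           Descent f s K → Descent f s (suc K)
  dip    : ∀ {s K} → f s (suc K) ≡ bump false → f (suc s) (suc K) ≡ bump false →
           Descent f (suc s) K → Descent f s (suc K)

module _ {f : Grid} where

  row : ∀ {s K} → Descent f s K → ℕ → ℕ
  row done k = 0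
  row {s} {suc K} (across _ _ D) k = if k ≡ᵇ suc K then s else row D k
  row {s} {suc K} (dip _ _ D) k = if k ≡ᵇ suc K then s else row D k

  cells : ∀ {s K} → Descent f s K → List Cell
  cells done = []
  cells {s} {suc K} (across _ _ D) = (s , suc K) ∷ cells D
  cells {s} {suc K} (dip _ _ D) = (s , suc K) ∷ (suc s , suc K) ∷ cells D

  next : ∀ {s K} → Descent f s (suc K) → ℕ
  next {s} (across _ _ _) = s
  next {s} (dip _ _ _) = suc s

  tail : ∀ {s K} (D : Descent f s (suc K)) → Descent f (next D) K
  tail (across _ _ D) = D
  tail (dip _ _ D) = D

  s≤next : ∀ {s K} (D : Descent f s (suc K)) → s ≤ next D
  s≤next (across _ _ _) = ≤-refl
  s≤next (dip _ _ _) = n≤1+n _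

  next≤1+s : ∀ {s K} (D : Descent f s (suc K)) → next D ≤ suc s
  next≤1+s (across _ _ _) = n≤1+n _
  next≤1+s (dip _ _ _) = ≤-refl

  row-top : ∀ {s K} (D : Descent f s (suc K)) → row D (suc K) ≡ s
  row-top {K = K} (across _ _ _) rewrite ≡ᵇ-refl K = refl
  row-top {K = K} (dip _ _ _) rewrite ≡ᵇ-refl K = refl

  row-tail : ∀ {s K k} (D : Descent f s (suc K)) → k ≤ K → row D k ≡ row (tail D) k
  row-tail {K = K} {k} (across _ _ _) k≤K rewrite ≡ᵇ-false (λ k≡ → <-irrefl k≡ (s≤s k≤K)) = refl
  row-tail {K = K} {k} (dip _ _ _) k≤K rewrite ≡ᵇ-false (λ k≡ → <-irrefl k≡ (s≤s k≤K)) = refl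

  starts-across : ∀ {s K} (D : Descent f s (suc K)) → f (suc s) (suc K) ≡ cross →
    next D ≡ s × (2 ≤ s → f (pred s) (suc K) ≢ bump false)
  starts-across (across _ up _) _ = refl , up
  starts-across (dip _ bump₂ _) cross₂ with trans (sym bump₂) cross₂
  ... | ()

  starts-dip : ∀ {s K b} (D : Descent f s (suc K)) → f s (suc K) ≡ bump b →
    next D ≡ suc s × f (suc s) (suc K) ≡ bump false
  starts-dip (across cross₁ _ _) bump₁ with trans (sym cross₁) bump₁
  ... | ()
  starts-dip (dip _ bump₂ _) _ = refl , bump₂

  row-≥ : ∀ {s K k} (D : Descent f s K) → 1 ≤ k → k ≤ K → s ≤ row D k
  row-≥ {K = zero} _ (s≤s _) ()
  row-≥ {K = suc K} D 1≤k k≤ with top-or-below k≤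
  ... | inj₁ refl = ≤-reflexive (sym (row-top D))
  ... | inj₂ k≤K = ≤-trans (s≤next D)
    (≤-trans (row-≥ (tail D) 1≤k k≤K) (≤-reflexive (sym (row-tail D k≤K))))

  row-bound : ∀ {s K k} (D : Descent f s K) → 1 ≤ k → k ≤ K → row D k + k ≤ s + K
  row-bound {K = zero} _ (s≤s _) ()
  row-bound {s} {suc K} D 1≤k k≤ with top-or-below k≤
  ... | inj₁ refl = ≤-reflexive (cong (_+ suc K) (row-top D))
  ... | inj₂ k≤K = ≤-trans (≤-reflexive (cong (_+ _) (row-tail D k≤K)))
    (≤-trans (row-bound (tail D) 1≤k k≤K)
      (≤-trans (+-monoˡ-≤ K (next≤1+s D)) (≤-reflexive (sym (+-suc s K)))))

  row-bump : ∀ {s K k b} (D : Descent f s K) → 1 ≤ k → k ≤ K →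
    f (row D k) k ≡ bump b → f (suc (row D k)) k ≡ bump false
  row-bump {K = zero} _ (s≤s _) ()
  row-bump {K = suc K} {b = b} D 1≤k k≤ bump₁ with top-or-below k≤
  ... | inj₁ refl = subst (λ r → f (suc r) (suc K) ≡ bump false) (sym (row-top D))
    (proj₂ (starts-dip D (subst (λ r → f r (suc K) ≡ bump b) (row-top D) bump₁)))
  ... | inj₂ k≤K = subst (λ r → f (suc r) _ ≡ bump false) (sym (row-tail D k≤K))
    (row-bump (tail D) 1≤k k≤K (subst (λ r → f r _ ≡ bump b) (row-tail D k≤K) bump₁))

  firstRowIn-cells : ∀ {s K} k (D : Descent f s K) → firstRowIn k (cells D) ≡ row D k
  firstRowIn-cells k done = refl
  firstRowIn-cells {K = suc K} k (across _ _ D) with k ≡ᵇ suc K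
  ... | true = refl
  ... | false = firstRowIn-cells k D
  firstRowIn-cells {K = suc K} k (dip _ _ D) with k ≡ᵇ suc K
  ... | true = refl
  ... | false = firstRowIn-cells k D

  suffix : ∀ {s K k} (D : Descent f s K) → k ≤ K →
    ∃ λ e → Σ (Descent f e k) λ Dₛ → ∀ j → 1 ≤ j → j ≤ k → row Dₛ j ≡ row D j
  suffix {s} D k≤K with m≤n⇒m<n∨m≡n k≤K
  ... | inj₂ refl = s , D , λ _ _ _ → refl
  suffix {K = zero} D _ | inj₁ ()
  suffix {K = suc K} D _ | inj₁ (s≤s k≤K) with suffix (tail D) k≤K
  ... | e , Dₛ , rows =
    e , Dₛ , λ j 1≤j j≤k → trans (rows j 1≤j j≤k) (sym (row-tail D (≤-trans j≤k k≤K)))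

-- conditions (ii) and (iii) of removability at one cell
Admissible : Grid → Cell → Set
Admissible f (i , k) = (f i k ≡ cross → 2 ≤ i → f (pred i) k ≢ bump false) × f i k ≢ bump true

crossing-admissible : ∀ {f i k} → f i k ≡ cross → (2 ≤ i → f (pred i) k ≢ bump false) →
  Admissible f (i , k)
crossing-admissible crossing up = (λ _ → up) , λ marked → case trans (sym crossing) marked of λ ()

unmarked-admissible : ∀ {f i k} → f i k ≡ bump false → Admissible f (i , k)
unmarked-admissible unmarked =
  (λ crossing → case trans (sym unmarked) crossing of λ ()) , λ marked → case trans (sym unmarked) marked of λ ()

cells-admissible : ∀ {f s K} (D : Descent f s K) → All (Admissible f) (cells D)
cells-admissible done = []
cells-admissible {f} (across crossing up D) = crossing-admissible {f} crossing up ∷ cells-admissible D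
cells-admissible {f} (dip bump₁ bump₂ D) =
  unmarked-admissible {f} bump₁ ∷ unmarked-admissible {f} bump₂ ∷ cells-admissible D

-- Deleting a descent

Shifted : ∀ {f s K} → Grid → Descent f s K → Set
Shifted {f} {K = K} g D = ∀ r k → 1 ≤ k → k ≤ K → g r k ≡ f (punchIn (row D k) r) k

Lifts : ∀ {f g e p p' K} → Descent f e K → Descent g p K → Descent f p' K → Set
Lifts {K = K} D D'' D' = ∀ k → 1 ≤ k → k ≤ K → punchIn (row D k) (row D'' k) ≡ row D' k

module _ {f g : Grid} where

  shifted-tail : ∀ {e K} (D : Descent f e (suc K)) → Shifted g D → Shifted g (tail D)
  shifted-tail D shifted r k 1≤k k≤K =
    trans (shifted r k 1≤k (m≤n⇒m≤1+n k≤K)) (cong (λ e → f (punchIn e r) k) (row-tail D k≤K))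

  shifted-top : ∀ {e K} (D : Descent f e (suc K)) → Shifted g D → ∀ r →
    g r (suc K) ≡ f (punchIn e r) (suc K)
  shifted-top {K = K} D shifted r =
    trans (shifted r (suc K) (s≤s z≤n) ≤-refl) (cong (λ e → f (punchIn e r) (suc K)) (row-top D))

  shifted-above : ∀ {e K r} (D : Descent f e (suc K)) → Shifted g D → r < e → g r (suc K) ≡ f r (suc K)
  shifted-above {K = K} D shifted r<e =
    trans (shifted-top D shifted _) (cong (λ x → f x (suc K)) (punchIn-< r<e))

  shifted-below : ∀ {e K r} (D : Descent f e (suc K)) → Shifted g D → e ≤ r → g r (suc K) ≡ f (suc r) (suc K)
  shifted-below {K = K} D shifted e≤r =
    trans (shifted-top D shifted _) (cong (λ x → f x (suc K)) (punchIn-≥ e≤r))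

  lifts-step : ∀ {e p p' K} (D : Descent f e (suc K)) (D'' : Descent g p (suc K)) (D' : Descent f p' (suc K)) →
    punchIn e p ≡ p' → Lifts (tail D) (tail D'') (tail D') → Lifts D D'' D'
  lifts-step {e} {p} {p'} {K} D D'' D' top lower k 1≤k k≤ with top-or-below k≤
  ... | inj₁ refl = begin
    punchIn (row D (suc K)) (row D'' (suc K)) ≡⟨ cong₂ punchIn (row-top D) (row-top D'') ⟩
    punchIn e p                               ≡⟨ top ⟩
    p'                                        ≡⟨ sym (row-top D') ⟩
    row D' (suc K)                            ∎
  ... | inj₂ k≤K = begin
    punchIn (row D k) (row D'' k)               ≡⟨ cong₂ punchIn (row-tail D k≤K) (row-tail D'' k≤K) ⟩
    punchIn (row (tail D) k) (row (tail D'') k) ≡⟨ lower k 1≤k k≤K ⟩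
    row (tail D') k                             ≡⟨ sym (row-tail D' k≤K) ⟩
    row D' k                                    ∎

  transport-above : ∀ {e p K} (D : Descent f e K) → Shifted g D → (D' : Descent f p K) → p < e →
    Σ (Descent g p K) λ D'' → Lifts D D'' D'
  transport-above done _ done _ = done , λ { _ (s≤s _) () }
  transport-above {e} {p} {suc K} D shifted D'@(across crossing up D'₀) p<e =
    D'' , lifts-step D D'' D' (punchIn-< p<e) (proj₂ lower)
    where
    lower = transport-above (tail D) (shifted-tail D shifted) D'₀ (<-≤-trans p<e (s≤next D))
    up'' : 2 ≤ p → g (pred p) (suc K) ≢ bump false
    up'' 2≤p = subst (_≢ bump false) (sym (shifted-above D shifted (≤-<-trans pred[n]≤n p<e))) (up 2≤p)
    D'' = across (trans (shifted-above D shifted p<e) crossing) up'' (proj₁ lower)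
  transport-above {e} {p} {suc K} D shifted D'@(dip bump₁ bump₂ D'₀) p<e
    with m≤n⇒m<n∨m≡n p<e
  ... | inj₁ p+1<e = D'' , lifts-step D D'' D' (punchIn-< p<e) (proj₂ lower)
    where
    lower = transport-above (tail D) (shifted-tail D shifted) D'₀ (<-≤-trans p+1<e (s≤next D))
    D'' = dip (trans (shifted-above D shifted p<e) bump₁) (trans (shifted-above D shifted p+1<e) bump₂) (proj₁ lower)
  -- the dip ends in D's entry row, so D dips as well and continues below it
  ... | inj₂ refl with starts-dip D bump₂
  ...   | next≡ , bump₃ = D'' , lifts-step D D'' D' (punchIn-< p<e) (proj₂ lower)
    where
    lower = transport-above (tail D) (shifted-tail D shifted) D'₀ (≤-reflexive (sym next≡))
    D'' = dip (trans (shifted-above D shifted p<e) bump₁) (trans (shifted-below D shifted ≤-refl) bump₃)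
            (proj₁ lower)

  next-above-crossing : ∀ {e q K} (D : Descent f e (suc K)) → e ≤ q → f (suc q) (suc K) ≡ cross →
    next D ≤ q
  next-above-crossing D e≤q crossing with m≤n⇒m<n∨m≡n e≤q
  ... | inj₁ e<q = ≤-trans (next≤1+s D) e<q
  ... | inj₂ refl = ≤-reflexive (proj₁ (starts-across D crossing))

  lowered-up : ∀ {e q K} (D : Descent f e (suc K)) → Shifted g D → e ≤ q → f (suc q) (suc K) ≡ cross →
    (2 ≤ suc q → f q (suc K) ≢ bump false) → 2 ≤ q → g (pred q) (suc K) ≢ bump false
  lowered-up {q = suc q} D shifted e≤q crossing up 2≤q with m≤n⇒m<n∨m≡n e≤q
  ... | inj₁ (s≤s e≤q-1) = subst (_≢ bump false) (sym (shifted-below D shifted e≤q-1)) (up (m≤n⇒m≤1+n 2≤q))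
  -- e = q: the crossing in row q + 1 is D's own, so D goes across there
  ... | inj₂ refl = subst (_≢ bump false) (sym (shifted-above D shifted ≤-refl))
                      (proj₂ (starts-across D crossing) 2≤q)

  transport-below : ∀ {e q K} (D : Descent f e K) → Shifted g D → (D' : Descent f (suc q) K) → e ≤ q →
    Σ (Descent g q K) λ D'' → Lifts D D'' D'
  transport-below done _ done _ = done , λ { _ (s≤s _) () }
  transport-below D shifted D'@(across crossing up D'₀) e≤q =
    D'' , lifts-step D D'' D' (punchIn-≥ e≤q) (proj₂ lower)
    where
    lower = transport-below (tail D) (shifted-tail D shifted) D'₀ (next-above-crossing D e≤q crossing)
    D'' = across (trans (shifted-below D shifted e≤q) crossing) (lowered-up D shifted e≤q crossing up) (proj₁ lower)
  transport-below D shifted D'@(dip bump₁ bump₂ D'₀) e≤q =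
    D'' , lifts-step D D'' D' (punchIn-≥ e≤q) (proj₂ lower)
    where
    lower = transport-below (tail D) (shifted-tail D shifted) D'₀ (≤-trans (next≤1+s D) (s≤s e≤q))
    D'' = dip (trans (shifted-below D shifted e≤q) bump₁)
              (trans (shifted-below D shifted (m≤n⇒m≤1+n e≤q)) bump₂) (proj₁ lower)

-- Removable pipes in a staircase

-- The shape of a removable pipe entering column c: it runs down t crossings
-- of column c, turns left in row t + 1 and then descends to the left boundary.
record RemovableShape (f : Grid) (m c t : ℕ) : Set where
  field
    1≤c       : 1 ≤ c
    t+c≤m     : t + c ≤ m
    crossings : ∀ i → 1 ≤ i → i ≤ t → f i c ≡ cross
    unmarked  : ∀ i → t < i → f i c ≡ bump false
    descent   : Descent f (suc t) (pred c)
open RemovableShape public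

turn-fits : ∀ {t c m} → 1 ≤ c → t + c ≤ m → suc t + pred c ≤ m
turn-fits {t} {suc c} {m} _ fits = subst (_≤ m) (+-suc t c) fits

fuel-step : ∀ {K F} → suc K + suc K ≤ suc F → suc (K + K) ≤ F
fuel-step {K} {F} (s≤s fuel) = subst (_≤ F) (+-suc K K) fuel

segment : ℕ → ℕ → ℕ → List Cell
segment zero i c = []
segment (suc n) i c = (i , c) ∷ segment n (suc i) c

∈-segment : ∀ {n i r} c → i ≤ r → r < i + n → (r , c) ∈ segment n i c
∈-segment {zero} {i} {r} c i≤r r<i+0 = contradiction (subst (r <_) (+-identityʳ i) r<i+0) (≤⇒≯ i≤r)
∈-segment {suc n} {i} {r} c i≤r r<i+n with m≤n⇒m<n∨m≡n i≤r
... | inj₂ refl = here refl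
... | inj₁ i<r = there (∈-segment c i<r (subst (r <_) (+-suc i n) r<i+n))

all-segment : ∀ {Q : Cell → Set} n i c → (∀ r → i ≤ r → r < i + n → Q (r , c)) → All Q (segment n i c)
all-segment zero i c _ = []
all-segment (suc n) i c q = q i ≤-refl (m<m+n i (s≤s z≤n)) ∷
  all-segment n (suc i) c (λ r i<r r<i+n → q r (<⇒≤ i<r) (subst (r <_) (sym (+-suc i n)) r<i+n))

atV-outside : ∀ {n} (v : Vec Tile n) i → n < i → atV v i ≡ bump false
atV-outside [] i _ = refl
atV-outside (_ ∷ _) zero _ = refl
atV-outside (_ ∷ _) (suc zero) (s≤s ())
atV-outside (_ ∷ v) (suc (suc i)) (s≤s n<1+i) = atV-outside v (suc i) n<1+i

at-outside : ∀ {m} (P : Staircase m) i k → suc m < i + k → at P i k ≡ bump false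
at-outside nil i k _ = refl
at-outside (col ◂ S) i zero _ = refl
at-outside {suc m} (col ◂ S) i (suc zero) out =
  atV-outside col i (≤-pred (subst (suc (suc m) <_) (+-comm i 1) out))
at-outside {suc m} (col ◂ S) i (suc (suc k)) out =
  at-outside S i (suc k) (≤-pred (subst (suc (suc m) <_) (+-suc i (suc k)) out))

at-row0 : ∀ {m} (P : Staircase m) k → at P 0 k ≡ bump false
at-row0 nil k = refl
at-row0 (col ◂ S) zero = refl
at-row0 ((_ ∷ _) ◂ S) (suc zero) = refl
at-row0 (col ◂ S) (suc (suc k)) = at-row0 S (suc k)

inStairᵇ-true : ∀ {m i k} → 1 ≤ i → 1 ≤ k → i + k ≤ suc m → inStairᵇ m i k ≡ true
inStairᵇ-true (s≤s _) (s≤s _) inside = ≤ᵇ-true inside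

Diagonal : ∀ {m} → Staircase m → Set
Diagonal {m} P = ∀ i k → 1 ≤ i → 1 ≤ k → i + k ≡ suc m → Σ Bool (λ b → at P i k ≡ bump b)

atV-tabulate : ∀ n (h : ℕ → Tile) r → r < n →
  atV (Vec.tabulate {n = n} (λ i → h (suc (toℕ i)))) (suc r) ≡ h (suc r)
atV-tabulate (suc n) h zero _ = refl
atV-tabulate (suc n) h (suc r) (s≤s r<n) = atV-tabulate n (h ∘ suc) r r<n

at-build : ∀ m h {r k} → 1 ≤ r → 1 ≤ k → r + k ≤ suc m → at (build m h) r k ≡ h r k
at-build zero h {suc r} {suc k} _ _ (s≤s inside) = contradiction (subst (_≤ 0) (+-suc r k) inside) λ ()
at-build (suc m) h {suc r} {suc zero} _ _ inside =
  atV-tabulate (suc m) (λ i → h i 1) r (subst (_≤ suc m) (+-comm r 1) (≤-pred inside))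
at-build (suc m) h {r} {suc (suc k)} 1≤r _ inside =
  at-build m (λ i k → h i (suc k)) 1≤r (s≤s z≤n) (≤-pred (subst (_≤ suc (suc m)) (+-suc r (suc k)) inside))

build-cong : ∀ m {h h'} → (∀ r k → 1 ≤ r → 1 ≤ k → r + k ≤ suc m → h r k ≡ h' r k) →
  build m h ≡ build m h'
build-cong zero _ = refl
build-cong (suc m) h≡h' = cong₂ _◂_
  (tabulate-cong λ i →
    h≡h' (suc (toℕ i)) 1 (s≤s z≤n) (s≤s z≤n) (s≤s (subst (_≤ suc m) (+-comm 1 (toℕ i)) (toℕ<n i))))
  (build-cong m λ r k 1≤r _ inside →
    h≡h' r (suc k) 1≤r (s≤s z≤n) (subst (_≤ suc (suc m)) (sym (+-suc r k)) (s≤s inside)))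

firstRowIn-segment : ∀ {k c} n i L → k ≢ c → firstRowIn k (segment n i c ++ L) ≡ firstRowIn k L
firstRowIn-segment zero i L _ = refl
firstRowIn-segment (suc n) i L k≢c rewrite ≡ᵇ-false k≢c = firstRowIn-segment n (suc i) L k≢c

module _ {m : ℕ} (P : Staircase m) where

  trace-col0 : ∀ F i d → trace P F i 0 d ≡ []
  trace-col0 zero i d = refl
  trace-col0 (suc F) zero d = refl
  trace-col0 (suc F) (suc i) d = refl

  trace-step : ∀ {F i k} d → 1 ≤ i → 1 ≤ k → i + k ≤ suc m →
    trace P (suc F) i k d ≡ (i , k) ∷ (if exitsLeft (at P i k) d
                                        then trace P F i (pred k) fromRight
                                        else trace P F (suc i) k fromTop)
  trace-step {F} {i} {suc zero} d 1≤i 1≤k inside rewrite inStairᵇ-true 1≤i 1≤k inside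
    with exitsLeft (at P i 1) d
  ... | true = cong ((i , 1) ∷_) (sym (trace-col0 F i fromRight))
  ... | false = refl
  trace-step {k = suc (suc k)} d 1≤i 1≤k inside rewrite inStairᵇ-true 1≤i 1≤k inside = refl

  trace-across : ∀ {F i k} → at P i k ≡ cross → 1 ≤ i → 1 ≤ k → i + k ≤ suc m →
    trace P (suc F) i k fromRight ≡ (i , k) ∷ trace P F i (pred k) fromRight
  trace-across {F} crossing 1≤i 1≤k inside rewrite trace-step {F} fromRight 1≤i 1≤k inside | crossing = refl

  trace-turn-down : ∀ {F i k b} → at P i k ≡ bump b → 1 ≤ i → 1 ≤ k → i + k ≤ suc m →
    trace P (suc F) i k fromRight ≡ (i , k) ∷ trace P F (suc i) k fromTop
  trace-turn-down {F} bumping 1≤i 1≤k inside rewrite trace-step {F} fromRight 1≤i 1≤k inside | bumping = refl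

  trace-down : ∀ {F i k} → at P i k ≡ cross → 1 ≤ i → 1 ≤ k → i + k ≤ suc m →
    trace P (suc F) i k fromTop ≡ (i , k) ∷ trace P F (suc i) k fromTop
  trace-down {F} crossing 1≤i 1≤k inside rewrite trace-step {F} fromTop 1≤i 1≤k inside | crossing = refl

  trace-turn-left : ∀ {F i k b} → at P i k ≡ bump b → 1 ≤ i → 1 ≤ k → i + k ≤ suc m →
    trace P (suc F) i k fromTop ≡ (i , k) ∷ trace P F i (pred k) fromRight
  trace-turn-left {F} bumping 1≤i 1≤k inside rewrite trace-step {F} fromTop 1≤i 1≤k inside | bumping = refl

  trace-column : ∀ {j c} d {i} F → i + d ≡ j → 1 ≤ i → 1 ≤ c → j + c ≤ suc m →
    (∀ r → i ≤ r → r < j → at P r c ≡ cross) → at P j c ≡ bump false →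
    trace P (suc d + F) i c fromTop ≡ segment (suc d) i c ++ trace P F j (pred c) fromRight
  trace-column zero {i} F i+0≡j 1≤i 1≤c fits _ bumping with trans (sym (+-identityʳ i)) i+0≡j
  ... | refl = trace-turn-left bumping 1≤i 1≤c fits
  trace-column {j} {c} (suc d) {i} F i+d≡j 1≤i 1≤c fits crossings bumping =
    trans (trace-down (crossings i ≤-refl i<j) 1≤i 1≤c (≤-trans (+-monoˡ-≤ c (<⇒≤ i<j)) fits))
      (cong ((i , c) ∷_) (trace-column d F (trans (sym (+-suc i d)) i+d≡j) (s≤s z≤n) 1≤c fits
                            (λ r i<r → crossings r (<⇒≤ i<r)) bumping))
    where
    i<j : i < j
    i<j = subst (i <_) i+d≡j (m<m+n i (s≤s z≤n))

  visits-column : ∀ {c t} → 1 ≤ c → t + c ≤ m → (∀ i → 1 ≤ i → i ≤ t → at P i c ≡ cross) →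
    at P (suc t) c ≡ bump false →
    ∃ λ F → pred c + pred c ≤ F × Visits P c ≡ segment (suc t) 1 c ++ trace P F (suc t) (pred c) fromRight
  visits-column {suc c₀} {t} _ fits crossings bumping = m + m ∸ suc t , fuel , (begin
    trace P (m + m) 1 (suc c₀) fromTop
      ≡⟨ cong (λ F → trace P F 1 (suc c₀) fromTop) (sym (m+[n∸m]≡n 1+t≤m+m)) ⟩
    trace P (suc t + (m + m ∸ suc t)) 1 (suc c₀) fromTop
      ≡⟨ trace-column t _ refl (s≤s z≤n) (s≤s z≤n) (s≤s fits)
           (λ r 1≤r r≤t → crossings r 1≤r (≤-pred r≤t)) bumping ⟩
    segment (suc t) 1 (suc c₀) ++ trace P (m + m ∸ suc t) (suc t) c₀ fromRight ∎)
    where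
    1+t≤m : suc t ≤ m
    1+t≤m = ≤-trans (≤-trans (s≤s (m≤m+n t c₀)) (≤-reflexive (sym (+-suc t c₀)))) fits
    1+t≤m+m : suc t ≤ m + m
    1+t≤m+m = ≤-trans 1+t≤m (m≤m+n m m)
    rearrange : ∀ a b → a + a + suc b ≡ a + (b + suc a)
    rearrange = solve-∀
    fuel : c₀ + c₀ ≤ m + m ∸ suc t
    fuel = m+n≤o⇒m≤o∸n (c₀ + c₀) (≤-trans (≤-reflexive (rearrange c₀ t))
             (+-mono-≤ (≤-trans (n≤1+n c₀) (m+n≤o⇒n≤o t fits)) fits))

  trace-descent : ∀ {s K F} (D : Descent (at P) s K) → 1 ≤ s → s + K ≤ m → K + K ≤ F →
    trace P F s K fromRight ≡ cells D
  trace-descent {F = F} done _ _ _ = trace-col0 F _ fromRight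
  trace-descent {F = zero} (across _ _ _) _ _ ()
  trace-descent {F = zero} (dip _ _ _) _ _ ()
  trace-descent {s} {suc K} {suc F} (across crossing _ D) 1≤s fits fuel =
    trans (trace-across crossing 1≤s (s≤s z≤n) (m≤n⇒m≤1+n fits))
      (cong ((s , suc K) ∷_)
        (trace-descent D 1≤s (≤-trans (+-monoʳ-≤ s (n≤1+n K)) fits) (<⇒≤ (fuel-step fuel))))
  trace-descent {K = suc K} {suc zero} (dip _ _ _) _ _ fuel = contradiction (fuel-step fuel) λ ()
  trace-descent {s} {suc K} {suc (suc F)} (dip bump₁ bump₂ D) 1≤s fits fuel =
    trans (trace-turn-down bump₁ 1≤s (s≤s z≤n) (m≤n⇒m≤1+n fits))
      (cong ((s , suc K) ∷_) (trans (trace-turn-left bump₂ (s≤s z≤n) (s≤s z≤n) (s≤s fits))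
        (cong ((suc s , suc K) ∷_)
          (trace-descent D (s≤s z≤n) (subst (_≤ m) (+-suc s K) fits) (≤-pred (fuel-step fuel))))))

  descent-of-trace : ∀ {s K F} → 1 ≤ s → s + K ≤ m → K + K ≤ F →
    All (Admissible (at P)) (trace P F s K fromRight) → Descent (at P) s K
  descent-after-turn : ∀ {s K F} → at P s (suc K) ≡ bump false → 1 ≤ s → s + suc K ≤ m →
    suc (K + K) ≤ F →
    All (Admissible (at P)) (trace P F (suc s) (suc K) fromTop) → Descent (at P) s (suc K)

  descent-of-trace {K = zero} _ _ _ _ = done
  descent-of-trace {K = suc K} {zero} _ _ () _
  descent-of-trace {s} {suc K} {suc F} 1≤s fits fuel admissible with at P s (suc K) in tile
  ... | cross = across tile (proj₁ (All.head admissible') tile)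
                  (descent-of-trace 1≤s (≤-trans (+-monoʳ-≤ s (n≤1+n K)) fits) (<⇒≤ (fuel-step fuel))
                    (All.tail admissible'))
    where admissible' = subst (All _) (trace-across tile 1≤s (s≤s z≤n) (m≤n⇒m≤1+n fits)) admissible
  ... | bump true = contradiction tile
          (proj₂ (All.head (subst (All _) (trace-turn-down tile 1≤s (s≤s z≤n) (m≤n⇒m≤1+n fits)) admissible)))
  ... | bump false = descent-after-turn tile 1≤s fits (fuel-step fuel)
          (All.tail (subst (All _) (trace-turn-down tile 1≤s (s≤s z≤n) (m≤n⇒m≤1+n fits)) admissible))

  descent-after-turn {F = zero} _ _ _ () _
  descent-after-turn {s} {K} {suc F} bump₁ 1≤s fits fuel admissible with at P (suc s) (suc K) in tile
  ... | cross = contradiction bump₁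
          (proj₁ (All.head (subst (All _) (trace-down tile (s≤s z≤n) (s≤s z≤n) (s≤s fits)) admissible))
             tile (s≤s 1≤s))
  ... | bump true = contradiction tile
          (proj₂ (All.head (subst (All _) (trace-turn-left tile (s≤s z≤n) (s≤s z≤n) (s≤s fits)) admissible)))
  ... | bump false = dip bump₁ tile
          (descent-of-trace (s≤s z≤n) (subst (_≤ m) (+-suc s K) fits) (≤-pred fuel)
            (All.tail (subst (All _) (trace-turn-left tile (s≤s z≤n) (s≤s z≤n) (s≤s fits)) admissible)))

  visits-shape : ∀ {c t} (S : RemovableShape (at P) m c t) →
    Visits P c ≡ segment (suc t) 1 c ++ cells (descent S)
  visits-shape {c} {t} S =
    trans (proj₂ (proj₂ column)) (cong (segment (suc t) 1 c ++_)
      (trace-descent (descent S) (s≤s z≤n) (turn-fits (1≤c S) (t+c≤m S)) (proj₁ (proj₂ column))))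
    where
    column = visits-column (1≤c S) (t+c≤m S) (crossings S) (unmarked S (suc t) ≤-refl)

  column-admissible : ∀ {c t} → (∀ i → 1 ≤ i → i ≤ t → at P i c ≡ cross) →
    at P (suc t) c ≡ bump false →
    All (Admissible (at P)) (segment (suc t) 1 c)
  column-admissible {c} {t} crossings bumping = all-segment (suc t) 1 c admissible
    where
    admissible : ∀ r → 1 ≤ r → r < suc (suc t) → Admissible (at P) (r , c)
    admissible r 1≤r r≤1+t with m≤n⇒m<n∨m≡n (≤-pred r≤1+t)
    ... | inj₂ refl = unmarked-admissible {at P} bumping
    ... | inj₁ r≤t = crossing-admissible {at P} (crossings r 1≤r (≤-pred r≤t)) λ 2≤r bumping' →
            case trans (sym (crossings (pred r) (<⇒≤pred 2≤r) (≤-trans pred[n]≤n (≤-pred r≤t)))) bumping'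
            of λ ()

  shape⇒removableCol : ∀ {c t} → RemovableShape (at P) m c t → RemovableCol P c
  shape⇒removableCol {c} {t} S =
    (t , (λ i 1≤i i≤t → crossings S i 1≤i i≤t , on-pipe i 1≤i i≤t) , (λ i t<i _ → unmarked S i t<i)) ,
    (λ i k visited → proj₁ (All.lookup admissible visited)) ,
    (λ i k visited → proj₂ (All.lookup admissible visited))
    where
    on-pipe : ∀ i → 1 ≤ i → i ≤ t → (i , c) ∈ Visits P c
    on-pipe i 1≤i i≤t =
      subst ((i , c) ∈_) (sym (visits-shape S)) (∈-++⁺ˡ (∈-segment c 1≤i (s≤s (m≤n⇒m≤1+n i≤t))))
    admissible : All (Admissible (at P)) (Visits P c)
    admissible = subst (All _) (sym (visits-shape S))
      (All.++⁺ (column-admissible (crossings S) (unmarked S (suc t) ≤-refl)) (cells-admissible (descent S)))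

  crossings-fit : ∀ {c t} → Diagonal P → 1 ≤ c → c ≤ m → (∀ i → 1 ≤ i → i ≤ t → at P i c ≡ cross) →
    t + c ≤ m
  crossings-fit {c} {t} diagonal 1≤c c≤m crossings with t + c ≤? m
  ... | yes fits = fits
  -- otherwise the run of crossings would reach the bumping diagonal
  ... | no overflow =
    case trans (sym (crossings i₀ 1≤i₀ i₀≤t)) (proj₂ (diagonal i₀ c 1≤i₀ 1≤c (m∸n+n≡m (m≤n⇒m≤1+n c≤m))))
    of λ ()
    where
    i₀ = suc m ∸ c
    1≤i₀ : 1 ≤ i₀
    1≤i₀ = subst (1 ≤_) (sym (+-∸-assoc 1 c≤m)) (s≤s z≤n)
    i₀≤t : i₀ ≤ t
    i₀≤t = subst (i₀ ≤_) (m+n∸n≡m t c) (∸-monoˡ-≤ c (≰⇒> overflow))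

  removableCol⇒shape : ∀ {c} → Diagonal P → 1 ≤ c → c ≤ m → RemovableCol P c →
    ∃ (RemovableShape (at P) m c)
  removableCol⇒shape {c} diagonal 1≤c c≤m ((t , run , after-run) , up , no-marks) = t , shape
    where
    run-crossings : ∀ i → 1 ≤ i → i ≤ t → at P i c ≡ cross
    run-crossings i 1≤i i≤t = proj₁ (run i 1≤i i≤t)
    fits : t + c ≤ m
    fits = crossings-fit diagonal 1≤c c≤m run-crossings
    unmarked-after-run : ∀ i → t < i → at P i c ≡ bump false
    unmarked-after-run i t<i with i + c ≤? suc m
    ... | yes inside = after-run i t<i inside
    ... | no outside = at-outside P i c (≰⇒> outside)
    column = visits-column 1≤c fits run-crossings (unmarked-after-run (suc t) ≤-refl)
    admissible : All (Admissible (at P)) (Visits P c)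
    admissible = All.tabulate λ { {i , k} visited → up i k visited , no-marks i k visited }
    shape : RemovableShape (at P) m c t
    shape = record
      { 1≤c = 1≤c
      ; t+c≤m = fits
      ; crossings = run-crossings
      ; unmarked = unmarked-after-run
      ; descent = descent-of-trace (s≤s z≤n) (turn-fits 1≤c fits) (proj₁ (proj₂ column))
                    (All.++⁻ʳ (segment (suc t) 1 c) (subst (All _) (proj₂ (proj₂ column)) admissible))
      }

  entry-row : ∀ {c t k} (S : RemovableShape (at P) m c t) → k < c → firstRowIn k (Visits P c) ≡ row (descent S) k
  entry-row {c} {t} {k} S k<c = begin
    firstRowIn k (Visits P c)
      ≡⟨ cong (firstRowIn k) (visits-shape S) ⟩
    firstRowIn k (segment (suc t) 1 c ++ cells (descent S))
      ≡⟨ firstRowIn-segment (suc t) 1 _ (λ k≡c → <-irrefl k≡c k<c) ⟩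
    firstRowIn k (cells (descent S))
      ≡⟨ firstRowIn-cells k (descent S) ⟩
    row (descent S) k ∎

  Φ-tile : ∀ {c t} (S : RemovableShape (at P) m c t) r k → 1 ≤ k →
    ΦcolTile P c r k ≡ uncurry (at P) (source (row (descent S)) c (r , k))
  Φ-tile {c} {t} S r k 1≤k with k <ᵇ c in k<ᵇc
  ... | false = refl
  ... | true rewrite entry-row S (<ᵇ≡true⇒< k<ᵇc) with r <ᵇ row (descent S) k
  ...   | true = refl
  ...   | false with at P (row (descent S) k) k in tile
  ...     | cross = refl
  ...     | bump b with r ≡ᵇ row (descent S) k in r≡ᵇ
  ...       | false = refl
  ...       | true = subst (λ x → bump false ≡ at P (suc x) k) (sym (≡ᵇ≡true⇒≡ r≡ᵇ))
                      (sym (row-bump (descent S) 1≤k (<⇒≤pred (<ᵇ≡true⇒< {n = c} k<ᵇc)) tile))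

module _ {m₁ : ℕ} (P : Staircase (suc m₁)) {c t} (S : RemovableShape (at P) (suc m₁) c t) where

  -- This holds for every cell: outside a staircase `at` reads an unmarked bump,
  -- and source maps cells outside the staircase of Φ_c P outside that of P.
  Φ-reindexes : ∀ r k → 1 ≤ k →
    at (build m₁ (ΦcolTile P c)) r k ≡ uncurry (at P) (source (row (descent S)) c (r , k))
  Φ-reindexes zero k 1≤k =
    trans (at-row0 (build m₁ _) k) (sym (trans (cong (λ x → at P x (punchIn c k)) row0) (at-row0 P _)))
    where
    row0 : liftRow (row (descent S)) c k 0 ≡ 0
    row0 with k <? c
    ... | yes k<c = trans (liftRow-< {row (descent S)} k<c)
                      (punchIn-< (≤-trans (s≤s z≤n) (row-≥ (descent S) 1≤k (<⇒≤pred k<c))))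
    ... | no k≮c = liftRow-≥ {row (descent S)} (≮⇒≥ k≮c)
  Φ-reindexes (suc r) k 1≤k with suc r + k ≤? suc m₁
  ... | yes inside = trans (at-build m₁ _ (s≤s z≤n) 1≤k inside) (Φ-tile P S (suc r) k 1≤k)
  ... | no outside = trans (at-outside (build m₁ _) (suc r) k (≰⇒> outside))
          (sym (at-outside P _ _ (≤-trans (s≤s (≰⇒> outside)) (source-moves (row (descent S)) c (suc r) k below))))
    where
    below : k < c → row (descent S) k ≤ suc r
    below k<c = <⇒≤ (+-cancelʳ-< k _ _ (≤-<-trans
      (≤-trans (row-bound (descent S) 1≤k (<⇒≤pred k<c)) (turn-fits (1≤c S) (t+c≤m S))) (≰⇒> outside)))

-- A second removable pipe survives

Reindexes : Grid → Grid → (ℕ → ℕ) → ℕ → Set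
Reindexes g f E c = ∀ r k → 1 ≤ k → g r k ≡ uncurry f (source E c (r , k))

module _ {f g : Grid} where

  shifted-of-reindexes : ∀ {c e K E} (D : Descent f e K) → Reindexes g f E c → K < c →
    (∀ k → 1 ≤ k → k ≤ K → row D k ≡ E k) → Shifted g D
  shifted-of-reindexes {c} {E = E} D reindexes K<c rows r k 1≤k k≤K = begin
    g r k                             ≡⟨ reindexes r k 1≤k ⟩
    f (liftRow E c k r) (punchIn c k) ≡⟨ cong₂ f (liftRow-< {E} k<c) (punchIn-< k<c) ⟩
    f (punchIn (E k) r) k             ≡⟨ cong (λ e → f (punchIn e r) k) (sym (rows k 1≤k k≤K)) ⟩
    f (punchIn (row D k) r) k         ∎
    where k<c = ≤-<-trans k≤K K<c

  relocates-of-lifts : ∀ {c e s s' K E E'} (D : Descent f e K) (D'' : Descent g s K) (D' : Descent f s' K) → K < c →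
    (∀ k → 1 ≤ k → k ≤ K → row D k ≡ E k) → (∀ k → 1 ≤ k → k ≤ K → row D' k ≡ E' k) →
    Lifts D D'' D' → Relocates E c (row D'') E' (suc K)
  relocates-of-lifts {c} {E = E} {E'} D D'' D' K<c rows rows' lifts k 1≤k (s≤s k≤K) = begin
    liftRow E c k (row D'' k)     ≡⟨ liftRow-< {E} k<c ⟩
    punchIn (E k) (row D'' k)     ≡⟨ cong (λ e → punchIn e (row D'' k)) (sym (rows k 1≤k k≤K)) ⟩
    punchIn (row D k) (row D'' k) ≡⟨ lifts k 1≤k k≤K ⟩
    row D' k                      ≡⟨ rows' k 1≤k k≤K ⟩
    E' k                          ≡⟨ cong E' (sym (punchIn-< k<c)) ⟩
    E' (punchIn c k)              ∎
    where k<c = ≤-<-trans k≤K K<c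

  column-shift : ∀ {c E r k} → Reindexes g f E c → 1 ≤ c → c ≤ k → g r k ≡ f r (suc k)
  column-shift {c} {E} {r} {k} reindexes 1≤c c≤k =
    trans (reindexes r k (≤-trans 1≤c c≤k)) (cong₂ f (liftRow-≥ {E} c≤k) (punchIn-≥ c≤k))

  relocate-column : ∀ {c s K E} (D'' : Descent g s (suc K)) (D' : Descent f s (suc (suc K))) → c ≤ suc K →
    Relocates E c (row (tail D'')) (row (tail D')) (suc K) → Relocates E c (row D'') (row D') (suc (suc K))
  relocate-column {c} {s} {K} {E} D'' D' c≤ lower k 1≤k k≤ with top-or-below k≤
  ... | inj₁ refl = begin
    liftRow E c (suc K) (row D'' (suc K)) ≡⟨ liftRow-≥ {E} c≤ ⟩
    row D'' (suc K)                       ≡⟨ row-top D'' ⟩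
    s                                     ≡⟨ sym (row-top D') ⟩
    row D' (suc (suc K))                  ≡⟨ cong (row D') (sym (punchIn-≥ c≤)) ⟩
    row D' (punchIn c (suc K))            ∎
  ... | inj₂ k<1+K = begin
    liftRow E c k (row D'' k)        ≡⟨ cong (liftRow E c k) (row-tail D'' (≤-pred k<1+K)) ⟩
    liftRow E c k (row (tail D'') k) ≡⟨ lower k 1≤k k<1+K ⟩
    row (tail D') (punchIn c k)      ≡⟨ sym (row-tail D' (≤-trans (punchIn≤1+j c k) k<1+K)) ⟩
    row D' (punchIn c k)             ∎

  pass-removed-column : ∀ {m t s K} (S : RemovableShape f (suc m) (suc K) t) →
    Reindexes g f (row (descent S)) (suc K) → 1 ≤ s → (D' : Descent f s (suc K)) →
    Σ (Descent g s K) λ D'' → Relocates (row (descent S)) (suc K) (row D'') (row D') (suc K)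
  pass-removed-column {t = t} {s} S reindexes 1≤s D'@(across crossing _ D'₀) =
    proj₁ passage , relocates-of-lifts (descent S) (proj₁ passage) D'₀ ≤-refl (λ _ _ _ → refl)
                      (λ k _ k≤K → sym (row-tail D' k≤K)) (proj₂ passage)
    where
    s≤t : s ≤ t
    s≤t = ≮⇒≥ λ t<s → case trans (sym crossing) (unmarked S s t<s) of λ ()
    passage = transport-above (descent S) (shifted-of-reindexes (descent S) reindexes ≤-refl (λ _ _ _ → refl))
                D'₀ (s≤s s≤t)
  pass-removed-column {t = t} {s} S reindexes 1≤s D'@(dip bumping _ D'₀) =
    proj₁ passage , relocates-of-lifts (descent S) (proj₁ passage) D'₀ ≤-refl (λ _ _ _ → refl)
                      (λ k _ k≤K → sym (row-tail D' k≤K)) (proj₂ passage)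
    where
    t<s : t < s
    t<s = ≰⇒> λ s≤t → case trans (sym (crossings S s 1≤s s≤t)) bumping of λ ()
    passage = transport-below (descent S) (shifted-of-reindexes (descent S) reindexes ≤-refl (λ _ _ _ → refl))
                D'₀ t<s

  descent-shift : ∀ {m c t s K} (S : RemovableShape f (suc m) c t) → Reindexes g f (row (descent S)) c →
    1 ≤ s → c ≤ suc K → (D' : Descent f s (suc K)) →
    Σ (Descent g s K) λ D'' → Relocates (row (descent S)) c (row D'') (row D') (suc K)
  descent-shift S reindexes 1≤s c≤ D' with m≤n⇒m<n∨m≡n c≤
  ... | inj₂ refl = pass-removed-column S reindexes 1≤s D'
  descent-shift {K = zero} S _ _ _ _ | inj₁ (s≤s c≤0) = contradiction (≤-trans (1≤c S) c≤0) λ ()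
  descent-shift {K = suc K} S reindexes 1≤s _ D'@(across crossing up D'₀) | inj₁ (s≤s c≤K) =
    D'' , relocate-column {E = row (descent S)} D'' D' c≤K (proj₂ lower)
    where
    shift : ∀ {r} → g r (suc K) ≡ f r (suc (suc K))
    shift = column-shift {E = row (descent S)} reindexes (1≤c S) c≤K
    lower = descent-shift S reindexes 1≤s c≤K D'₀
    D'' = across (trans shift crossing) (λ 2≤s → subst (_≢ bump false) (sym shift) (up 2≤s)) (proj₁ lower)
  descent-shift {K = suc K} S reindexes 1≤s _ D'@(dip bump₁ bump₂ D'₀) | inj₁ (s≤s c≤K) =
    D'' , relocate-column {E = row (descent S)} D'' D' c≤K (proj₂ lower)
    where
    shift : ∀ {r} → g r (suc K) ≡ f r (suc (suc K))
    shift = column-shift {E = row (descent S)} reindexes (1≤c S) c≤K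
    lower = descent-shift S reindexes (s≤s z≤n) c≤K D'₀
    D'' = dip (trans shift bump₁) (trans shift bump₂) (proj₁ lower)

  Survives : ∀ {m c t c' t'} → RemovableShape f (suc m) c t → RemovableShape f (suc m) c' t' → ℕ → Set
  Survives {m} {c} S S' c'' = ∃ λ t'' → Σ (RemovableShape g m c'' t'') λ S'' →
    Relocates (row (descent S)) c (row (descent S'')) (row (descent S')) c''

  -- Pipe c passes column c' < c, entering it in row e along the final part Dₛ
  -- of its descent.
  module Passage {m c t c'₀ e} (S : RemovableShape f (suc m) c t) (reindexes : Reindexes g f (row (descent S)) c)
    (c'<c : suc c'₀ < c) (Dₛ : Descent f e (suc c'₀))
    (rows : ∀ j → 1 ≤ j → j ≤ suc c'₀ → row Dₛ j ≡ row (descent S) j)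
    where

    e≡ : e ≡ row (descent S) (suc c'₀)
    e≡ = trans (sym (row-top Dₛ)) (rows (suc c'₀) (s≤s z≤n) ≤-refl)

    1≤e : 1 ≤ e
    1≤e = ≤-trans (s≤s z≤n) (subst (suc t ≤_) (sym e≡) (row-≥ (descent S) (s≤s z≤n) (<⇒≤pred c'<c)))

    e+c'≤1+m : e + suc c'₀ ≤ suc m
    e+c'≤1+m = subst (λ x → x + suc c'₀ ≤ suc m) (sym e≡)
      (≤-trans (row-bound (descent S) (s≤s z≤n) (<⇒≤pred c'<c)) (turn-fits (1≤c S) (t+c≤m S)))

    column : ∀ i → g i (suc c'₀) ≡ f (punchIn e i) (suc c'₀)
    column i = trans (reindexes i (suc c'₀) (s≤s z≤n))
      (cong₂ f (trans (liftRow-< {row (descent S)} c'<c) (cong (λ x → punchIn x i) (sym e≡))) (punchIn-< c'<c))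

    rows₀ : ∀ k → 1 ≤ k → k ≤ c'₀ → row (tail Dₛ) k ≡ row (descent S) k
    rows₀ k 1≤k k≤ = trans (sym (row-tail Dₛ k≤)) (rows k 1≤k (m≤n⇒m≤1+n k≤))

    shifted : Shifted g (tail Dₛ)
    shifted = shifted-of-reindexes (tail Dₛ) reindexes (<-trans (n<1+n c'₀) c'<c) rows₀

    relocates : ∀ {s s'} (D'' : Descent g s c'₀) (D' : Descent f s' c'₀) → Lifts (tail Dₛ) D'' D' →
      Relocates (row (descent S)) c (row D'') (row D') (suc c'₀)
    relocates D'' D' = relocates-of-lifts (tail Dₛ) D'' D' (<-trans (n<1+n c'₀) c'<c) rows₀ (λ _ _ _ → refl)

  pass-surviving-column : ∀ {m c t c'₀ t' e} (S : RemovableShape f (suc m) c t)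
    (reindexes : Reindexes g f (row (descent S)) c)
    (S' : RemovableShape f (suc m) (suc c'₀) t') (c'<c : suc c'₀ < c) (Dₛ : Descent f e (suc c'₀)) →
    (∀ j → 1 ≤ j → j ≤ suc c'₀ → row Dₛ j ≡ row (descent S) j) → Survives S S' (suc c'₀)
  pass-surviving-column {t' = zero} S reindexes S' c'<c Dₛ@(across crossing _ _) rows =
    contradiction (trans (sym crossing) (unmarked S' _ (Passage.1≤e S reindexes c'<c Dₛ rows))) λ ()
  -- pipe c crosses the run of pipe c', which loses one crossing
  pass-surviving-column {m} {c'₀ = c'₀} {suc t₀} {e} S reindexes S' c'<c Dₛ@(across crossing _ Dₛ₀) rows =
    t₀ , S'' , relocates (proj₁ passage) (descent S') (proj₂ passage)
    where
    open Passage S reindexes c'<c Dₛ rows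
    e≤t' : e ≤ suc t₀
    e≤t' = ≮⇒≥ λ t'<e → case trans (sym crossing) (unmarked S' e t'<e) of λ ()
    passage = transport-below Dₛ₀ shifted (descent S') e≤t'
    S'' : RemovableShape g m (suc c'₀) t₀
    S'' = record
      { 1≤c = s≤s z≤n
      ; t+c≤m = ≤-pred (t+c≤m S')
      ; crossings = λ i 1≤i i≤t₀ → trans (column i)
          (crossings S' _ (≤-trans 1≤i (j≤punchIn e i)) (≤-trans (punchIn≤1+j e i) (s≤s i≤t₀)))
      ; unmarked = λ i t₀<i → trans (column i)
          (unmarked S' _ (subst (suc t₀ <_) (sym (punchIn-≥ (≤-trans e≤t' t₀<i))) (s≤s t₀<i)))
      ; descent = proj₁ passage
      }
  -- pipe c passes below the run of pipe c'
  pass-surviving-column {m} {c'₀ = c'₀} {t'} {e} S reindexes S' c'<c Dₛ@(dip bumping _ Dₛ₀) rows =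
    t' , S'' , relocates (proj₁ passage) (descent S') (proj₂ passage)
    where
    open Passage S reindexes c'<c Dₛ rows
    t'<e : t' < e
    t'<e = ≰⇒> λ e≤t' → case trans (sym (crossings S' e 1≤e e≤t')) bumping of λ ()
    passage = transport-above Dₛ₀ shifted (descent S') (s≤s t'<e)
    S'' : RemovableShape g m (suc c'₀) t'
    S'' = record
      { 1≤c = s≤s z≤n
      ; t+c≤m = ≤-pred (≤-trans (+-monoˡ-< (suc c'₀) t'<e) e+c'≤1+m)
      ; crossings = λ i 1≤i i≤t' → trans (column i)
          (trans (cong (λ x → f x (suc c'₀)) (punchIn-< (≤-<-trans i≤t' t'<e))) (crossings S' i 1≤i i≤t'))
      ; unmarked = λ i t'<i → trans (column i) (unmarked S' _ (<-≤-trans t'<i (j≤punchIn e i)))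
      ; descent = proj₁ passage
      }

  survive-left : ∀ {m c t c' t'} (S : RemovableShape f (suc m) c t) → Reindexes g f (row (descent S)) c →
    (S' : RemovableShape f (suc m) c' t') → c' < c → Survives S S' c'
  survive-left {c' = zero} _ _ S' _ = contradiction (1≤c S') λ ()
  survive-left {c' = suc c'₀} S reindexes S' c'<c with suffix (descent S) (<⇒≤pred c'<c)
  ... | e , Dₛ , rows = pass-surviving-column S reindexes S' c'<c Dₛ rows

  survive-right : ∀ {m c t c' t'} (S : RemovableShape f (suc m) c t) → Reindexes g f (row (descent S)) c →
    (S' : RemovableShape f (suc m) c' t') → c < c' → Survives S S' (pred c')
  survive-right {c' = suc zero} S _ _ (s≤s c≤0) = contradiction (≤-trans (1≤c S) c≤0) λ ()
  survive-right {m} {c' = suc (suc K)} {t'} S reindexes S' (s≤s c≤) = t' , S'' , proj₂ shifted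
    where
    shifted = descent-shift S reindexes (s≤s z≤n) c≤ (descent S')
    column : ∀ {i} → g i (suc K) ≡ f i (suc (suc K))
    column = column-shift {E = row (descent S)} reindexes (1≤c S) c≤
    S'' : RemovableShape g m (suc K) t'
    S'' = record
      { 1≤c = s≤s z≤n
      ; t+c≤m = ≤-pred (subst (_≤ suc m) (+-suc t' (suc K)) (t+c≤m S'))
      ; crossings = λ i 1≤i i≤t' → trans column (crossings S' i 1≤i i≤t')
      ; unmarked = λ i t'<i → trans column (unmarked S' i t'<i)
      ; descent = proj₁ shifted
      }

  survive : ∀ {m c t c' t'} (S : RemovableShape f (suc m) c t) → Reindexes g f (row (descent S)) c →
    (S' : RemovableShape f (suc m) c' t') → c ≢ c' → Survives S S' (punchOut c c')
  survive {c = c} {c' = c'} S reindexes S' c≢c' with <-cmp c' c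
  ... | tri≈ _ c'≡c _ = contradiction (sym c'≡c) c≢c'
  ... | tri< c'<c _ _ rewrite punchOut-< c'<c = survive-left S reindexes S' c'<c
  ... | tri> _ _ c<c' rewrite punchOut-≥ (<⇒≤ c<c') = survive-right S reindexes S' c<c'

module _ {m : ℕ} (P : Staircase (suc m)) {c t c' t'} (S : RemovableShape (at P) (suc m) c t)
  (S' : RemovableShape (at P) (suc m) c' t') (c≢c' : c ≢ c') where

  private
    Q = build m (ΦcolTile P c)
    Q' = build m (ΦcolTile P c')
    survivor = survive S (Φ-reindexes P S) S' c≢c'
    survivor' = survive S' (Φ-reindexes P S') S (c≢c' ∘ sym)
    S'' = proj₁ (proj₂ survivor)
    S̃ = proj₁ (proj₂ survivor')

  Φ-removable : RemovableCol Q (punchOut c c')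
  Φ-removable = shape⇒removableCol Q S''

  Φ-comm : build (m ∸ 1) (ΦcolTile Q (punchOut c c')) ≡ build (m ∸ 1) (ΦcolTile Q' (punchOut c' c))
  Φ-comm = build-cong (m ∸ 1) λ r k _ 1≤k _ → begin
    ΦcolTile Q (punchOut c c') r k
      ≡⟨ Φ-tile Q S'' r k 1≤k ⟩
    uncurry (at Q) (source E'' (punchOut c c') (r , k))
      ≡⟨ Φ-reindexes P S _ _ (≤-trans 1≤k (j≤punchIn (punchOut c c') k)) ⟩
    uncurry (at P) (source E c (source E'' (punchOut c c') (r , k)))
      ≡⟨ cong (uncurry (at P))
           (source-comm {E = E} {E'} {E''} {Ẽ} c≢c' (proj₂ (proj₂ survivor)) (proj₂ (proj₂ survivor')) r k 1≤k) ⟩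
    uncurry (at P) (source E' c' (source Ẽ (punchOut c' c) (r , k)))
      ≡⟨ sym (Φ-reindexes P S' _ _ (≤-trans 1≤k (j≤punchIn (punchOut c' c) k))) ⟩
    uncurry (at Q') (source Ẽ (punchOut c' c) (r , k))
      ≡⟨ sym (Φ-tile Q' S̃ r k 1≤k) ⟩
    ΦcolTile Q' (punchOut c' c) r k ∎
    where
    E = row (descent S)
    E' = row (descent S')
    E'' = row (descent S'')
    Ẽ = row (descent S̃)

-- Labels

colOf≤length : ∀ ls j → colOf ls j ≤ length ls
colOf≤length [] j = z≤n
colOf≤length (a ∷ as) j with a ≡ᵇ j
... | true = s≤s z≤n
... | false = s≤s (colOf≤length as j)

1≤colOf : ∀ {ls j} → j ∈ ls → 1 ≤ colOf ls j
1≤colOf {a ∷ as} {j} _ with a ≡ᵇ j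
... | true = s≤s z≤n
... | false = s≤s z≤n

∈-tail : ∀ {a j : ℕ} {as} → j ∈ a ∷ as → a ≢ j → j ∈ as
∈-tail (here j≡a) a≢j = contradiction (sym j≡a) a≢j
∈-tail (there j∈) _ = j∈

colOf-injective : ∀ {ls j j'} → j ∈ ls → j' ∈ ls → colOf ls j ≡ colOf ls j' → j ≡ j'
colOf-injective {a ∷ as} {j} {j'} j∈ j'∈ same with a ≟ j | a ≟ j'
... | yes refl | yes refl = refl
... | yes refl | no a≢j' rewrite ≡ᵇ-refl a | ≡ᵇ-false a≢j' =
  contradiction (suc-injective same) (<⇒≢ (1≤colOf (∈-tail j'∈ a≢j')))
... | no a≢j | yes refl rewrite ≡ᵇ-false a≢j | ≡ᵇ-refl a =
  contradiction (sym (suc-injective same)) (<⇒≢ (1≤colOf (∈-tail j∈ a≢j)))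
... | no a≢j | no a≢j' rewrite ≡ᵇ-false a≢j | ≡ᵇ-false a≢j' =
  colOf-injective (∈-tail j∈ a≢j) (∈-tail j'∈ a≢j') (suc-injective same)

∈-delete : ∀ {j j'} ls → j ≢ j' → j' ∈ ls → j' ∈ delete j ls
∈-delete {j} {j'} (a ∷ as) j≢j' j'∈ with a ≟ j
... | yes refl rewrite ≡ᵇ-refl a = ∈-tail j'∈ j≢j'
... | no a≢j rewrite ≡ᵇ-false a≢j with j'∈
...   | here j'≡a = here j'≡a
...   | there j'∈as = there (∈-delete as j≢j' j'∈as)

delete-comm : ∀ {j j'} ls → delete j (delete j' ls) ≡ delete j' (delete j ls)
delete-comm [] = refl
delete-comm {j} {j'} (a ∷ as) with a ≟ j | a ≟ j'
... | yes refl | yes refl = refl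
... | yes refl | no a≢j' rewrite ≡ᵇ-refl a | ≡ᵇ-false a≢j' | ≡ᵇ-refl a = refl
... | no a≢j | yes refl rewrite ≡ᵇ-refl a | ≡ᵇ-false a≢j | ≡ᵇ-refl a = refl
... | no a≢j | no a≢j' rewrite ≡ᵇ-false a≢j | ≡ᵇ-false a≢j' | ≡ᵇ-false a≢j =
  cong (a ∷_) (delete-comm as)

colOf-delete : ∀ {j j'} ls → j ∈ ls → j' ∈ ls → j ≢ j' →
  colOf (delete j ls) j' ≡ punchOut (colOf ls j) (colOf ls j')
colOf-delete {j} {j'} (a ∷ as) j∈ j'∈ j≢j' with a ≟ j | a ≟ j'
... | yes refl | yes refl = contradiction refl j≢j'
... | yes refl | no a≢j' rewrite ≡ᵇ-refl a | ≡ᵇ-false a≢j' = refl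
... | no a≢j | yes refl rewrite ≡ᵇ-false a≢j | ≡ᵇ-refl a =
  sym (punchOut-< (s≤s (1≤colOf (∈-tail j∈ a≢j))))
... | no a≢j | no a≢j' rewrite ≡ᵇ-false a≢j | ≡ᵇ-false a≢j' =
  trans (cong suc (colOf-delete as (∈-tail j∈ a≢j) (∈-tail j'∈ a≢j') j≢j'))
        (sym (punchOut-suc {colOf as j} (1≤colOf (∈-tail j'∈ a≢j'))))

proposition3p2 : (n : ℕ) (w : Permutation′ n) (P : Staircase n) (j j' : ℕ) →
    IsMarkedRPDPerm w P → j ≢ j' →
    Removable (permDream P) j → Removable (permDream P) j' →
    Removable (Φ j (permDream P)) j' × (Φ j' (Φ j (permDream P)) ≡ Φ j (Φ j' (permDream P)))
proposition3p2 zero w P j j' _ _ (() , _) _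
proposition3p2 (suc m) w P j j' marked j≢j' (j∈ , removable) (j'∈ , removable') =
  (∈-delete ls j≢j' j'∈ ,
   subst (RemovableCol _) (sym (colOf-delete ls j∈ j'∈ j≢j')) (Φ-removable P S S' c≢c')) ,
  cong₂ ⟨_,_⟩ (delete-comm {j'} {j} ls) tiles-comm
  where
  ls = labels (permDream P)
  shape : ∀ {i} → i ∈ ls → RemovableCol P (colOf ls i) → ∃ (RemovableShape (at P) (suc m) (colOf ls i))
  shape {i} i∈ = removableCol⇒shape P (proj₁ (proj₂ (proj₂ (proj₂ marked)))) (1≤colOf i∈)
               (subst (colOf ls i ≤_) (proj₁ marked) (colOf≤length ls i))
  S = proj₂ (shape j∈ removable)
  S' = proj₂ (shape j'∈ removable')
  c≢c' : colOf ls j ≢ colOf ls j'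
  c≢c' = j≢j' ∘ colOf-injective j∈ j'∈
  tiles-comm : build (m ∸ 1) (ΦcolTile (build m (ΦcolTile P (colOf ls j))) (colOf (delete j ls) j'))
        ≡ build (m ∸ 1) (ΦcolTile (build m (ΦcolTile P (colOf ls j'))) (colOf (delete j' ls) j))
  tiles-comm rewrite colOf-delete ls j∈ j'∈ j≢j' | colOf-delete ls j'∈ j∈ (j≢j' ∘ sym) = Φ-comm P S S' c≢c'
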